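{- Let $m$ be an odd positive integer and let $F:\mathbb{F}_{2^m}^3\to\mathbb{F}_{2^m}^3$ be defined by $F(x,y,z)=(f(x,y,z),f(y,z,x),f(z,x,y))$, where $f(x,y,z)=x^3+x^2y+xy^2+x^2z+yz^2$. Then $F$ is a permutation of $\mathbb{F}_{2^m}^3$.
   Context: $\mathbb{F}_{2^m}$ denotes the finite field with $2^m$ elements and $\mathbb{F}_{2^m}^3$ the 3-dimensional vector space over it. A permutation of $\mathbb{F}_{2^m}^3$ is a bijection from $\mathbb{F}_{2^m}^3$ to itself. -}

module Defs where

open import Level using (0ℓ)
open import Data.Nat using (ℕ; _^_) renaming (_+_ to _+ℕ_; _*_ to _*ℕ_)
open import Data.Fin using (Fin)
open import Data.Product using (_×_; _,_; ∃)
open import Relation.Binary.PropositionalEquality using (_≡_)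
open import Relation.Nullary using (¬_)
open import Algebra.Structures using (IsCommutativeRing)
open import Function.Bundles using (_↔_)
open import Function.Definitions using (Bijective)

Odd : ℕ → Set
Odd m = ∃ λ k → m ≡ 1 +ℕ 2 *ℕ k

-- A finite field with exactly 2^m elements (any such field is F_{2^m},
-- unique up to isomorphism). Equality is propositional equality.
record GF (m : ℕ) : Set₁ where
  infixl 6 _+_
  infixl 7 _*_
  field
    Carrier : Set
    _+_ _*_ : Carrier → Carrier → Carrier
    -_ : Carrier → Carrier
    0# 1# : Carrier
    isCommutativeRing : IsCommutativeRing (_≡_ {A = Carrier}) _+_ _*_ -_ 0# 1#
    0≢1 : ¬ (0# ≡ 1#)
    inverse : ∀ x → ¬ (x ≡ 0#) → ∃ λ y → x * y ≡ 1#
    card : Carrier ↔ Fin (2 ^ m)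

module _ {m : ℕ} (K : GF m) where
  open GF K

  f : Carrier → Carrier → Carrier → Carrier
  f x y z = x * x * x + x * x * y + x * y * y + x * x * z + y * z * z

  F : Carrier × Carrier × Carrier → Carrier × Carrier × Carrier
  F (x , y , z) = f x y z , f y z x , f z x y

  IsPermutation : (Carrier × Carrier × Carrier → Carrier × Carrier × Carrier) → Set
  IsPermutation G = Bijective _≡_ _≡_ G

module Submission where

-- Over a field of characteristic two put s = x + y + z, u = y + z, v = z + x, t = s² and
-- n = u² + uv + v². Then F(x, y, z) = s³ + (tu + (n + t)v, (n + t)u + nv, nu + tv). These three
-- components sum to s³, and their second elementary symmetric function plus t³ is (n + t)³; so, once
-- cubing is injective, F determines s and n, and then (u, v) as the solution of a linear system of
-- determinant n² + nt + t². Cubing is injective, and the form n² + nt + t² vanishes only at 0, as long as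
-- K has no root of w² + w + 1. This, and characteristic two itself, come from counting orbits:
-- multiplication by such a root w (respectively negation, in odd characteristic) permutes K with the
-- single fixed point 0 and all other orbits of size 3 (respectively 2), forcing 2^m ≡ 1 modulo 3
-- (respectively 2), which fails for m odd. Finally, an injective self-map of the finite set K³ is onto.

open import Defs hiding (f)

open import Level using (0ℓ)
open import Algebra.Bundles using (CommutativeRing; RawRing)
import Algebra.Properties.Group as GroupProperties
import Algebra.Properties.Ring as RingProperties
import Algebra.Solver.Ring as Solver
open import Algebra.Solver.Ring.AlmostCommutativeRing using (fromCommutativeRing; _-Raw-AlmostCommutative⟶_)
open import Data.Bool.Base using (Bool; true; false)
open import Data.Bool.Properties using (xor-∧-commutativeRing) renaming (_≟_ to _≟ᵇ_)
open import Data.Empty using (⊥-elim)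
open import Data.Fin.Base using (Fin; zero; suc)
open import Data.Fin.Properties using (any?; injective⇒≤; inj⇒≟; *↔×) renaming (_≟_ to _≟ᶠ_)
open import Data.List.Base as List using (List; []; _∷_; _++_; length; filter; tabulate)
open import Data.List.Properties using (length-++; length-tabulate; length-iterate)
open import Data.List.Membership.Propositional using (_∈_; find; lose)
open import Data.List.Membership.Propositional.Properties
  using (∈-tabulate⁺; ∈-filter⁺; ∈-filter⁻; ∈-++⁺ˡ; ∈-++⁺ʳ; ∈-++⁻)
open import Data.List.Membership.Propositional.Properties.WithK using (unique∧set⇒bag)
open import Data.List.Relation.Binary.BagAndSetEquality using (_∼[_]_; set; ∼bag⇒↭)
open import Data.List.Relation.Binary.Permutation.Propositional.Properties using (↭-length)
open import Data.List.Relation.Binary.Subset.Propositional using (_⊆_)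
open import Data.List.Relation.Unary.All using ([]; _∷_)
open import Data.List.Relation.Unary.AllPairs using ([]; _∷_)
open import Data.List.Relation.Unary.Any as Any using (Any; here; there)
open import Data.List.Relation.Unary.Unique.Propositional using (Unique)
open import Data.List.Relation.Unary.Unique.Propositional.Properties using (++⁺; filter⁺; tabulate⁺)
import Data.Maybe.Base as Maybe
open import Data.Nat.Base as Nat using (ℕ; zero; suc; _<_; s≤s; z≤n)
open import Data.Nat.DivMod using ([m+kn]%n≡m%n)
open import Data.Nat.GeneralisedArithmetic using (iterate)
open import Data.Nat.Induction using (<-rec)
open import Data.Nat.Properties as ℕₚ using (even≢odd; 1+n≰n; m≤n+m)
open import Data.Nat.Tactic.RingSolver using (solve-∀)
open import Data.Product.Base using (∃; _×_; _,_; proj₁; proj₂)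
open import Data.Product.Function.NonDependent.Propositional using (_×-↔_)
open import Data.Sum.Base using (_⊎_; inj₁; inj₂; [_,_]′; fromInj₂; reduce)
open import Function.Base using (_∘_)
open import Function.Bundles using (_↔_; Inverse; Injection; mk⇔)
open import Function.Consequences.Propositional using (strictlySurjective⇒surjective)
open import Function.Definitions using (Injective; Surjective; StrictlySurjective)
open import Function.Properties.Inverse using (↔-sym; ↔-trans; ↔⇒↣)
open import Relation.Binary.Definitions using (DecidableEquality)
open import Relation.Binary.PropositionalEquality
open import Relation.Nullary using (yes; no; ¬?)
open import Relation.Nullary.Decidable using (decidable-stable; dec⇒maybe)

module _ where
  open Nat using (_+_; _*_; _^_; _%_)

  2^n≢1+k*2 : ∀ {n} k → 0 < n → 2 ^ n ≢ 1 + k * 2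
  2^n≢1+k*2 {suc n} k _ e = even≢odd (2 ^ n) k (trans e (cong suc (ℕₚ.*-comm k 2)))

  2^[1+2j]%3≡2 : ∀ j → 2 ^ (1 + 2 * j) % 3 ≡ 2
  2^[1+2j]%3≡2 zero = refl
  2^[1+2j]%3≡2 (suc j) = begin
    2 ^ (1 + 2 * suc j) % 3           ≡⟨ cong (λ n → 2 ^ n % 3) (exponent j) ⟩
    2 ^ (2 + (1 + 2 * j)) % 3         ≡⟨ cong (_% 3) (times-four (2 ^ (1 + 2 * j))) ⟩
    (2 ^ (1 + 2 * j) + 2 ^ (1 + 2 * j) * 3) % 3 ≡⟨ [m+kn]%n≡m%n (2 ^ (1 + 2 * j)) (2 ^ (1 + 2 * j)) 3 ⟩
    2 ^ (1 + 2 * j) % 3               ≡⟨ 2^[1+2j]%3≡2 j ⟩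
    2                                 ∎
    where
    open ≡-Reasoning
    exponent : ∀ i → 1 + 2 * suc i ≡ 2 + (1 + 2 * i)
    exponent = solve-∀
    times-four : ∀ a → 2 * (2 * a) ≡ a + a * 3
    times-four = solve-∀

  2^odd≢1+k*3 : ∀ {n} k → Odd n → 2 ^ n ≢ 1 + k * 3
  2^odd≢1+k*3 k (j , refl) e with trans (sym (2^[1+2j]%3≡2 j)) (trans (cong (_% 3) e) ([m+kn]%n≡m%n 1 k 3))
  ... | ()

unique∧set⇒length≡ : ∀ {A : Set} {xs ys : List A} → Unique xs → Unique ys → xs ∼[ set ] ys → length xs ≡ length ys
unique∧set⇒length≡ xs! ys! xs∼ys = ↭-length (∼bag⇒↭ (unique∧set⇒bag xs! ys! xs∼ys))

Fin-injective⇒strictlySurjective : ∀ {n} (f : Fin n → Fin n) → Injective _≡_ _≡_ f → StrictlySurjective _≡_ f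
Fin-injective⇒strictlySurjective {n} f f-injective y with any? (λ i → f i ≟ᶠ y)
... | yes hit = hit
... | no miss = ⊥-elim (1+n≰n (injective⇒≤ {f = with-y} with-y-injective))
  where
  with-y : Fin (suc n) → Fin n
  with-y zero    = y
  with-y (suc i) = f i
  with-y-injective : Injective _≡_ _≡_ with-y
  with-y-injective {zero}  {zero}  _ = refl
  with-y-injective {zero}  {suc j} e = ⊥-elim (miss (j , sym e))
  with-y-injective {suc i} {zero}  e = ⊥-elim (miss (i , e))
  with-y-injective {suc i} {suc j} e = cong suc (f-injective e)

×-↔Fin : ∀ {A B : Set} {m n} → A ↔ Fin m → B ↔ Fin n → (A × B) ↔ Fin (m Nat.* n)
×-↔Fin A↔Fin B↔Fin = ↔-trans (A↔Fin ×-↔ B↔Fin) (↔-sym *↔×)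

module _ {A : Set} {n : ℕ} (A↔Fin : A ↔ Fin n) where
  open Inverse A↔Fin using (to; from; strictlyInverseʳ)
  open Injection (↔⇒↣ A↔Fin) using () renaming (injective to to-injective)
  open Injection (↔⇒↣ (↔-sym A↔Fin)) using () renaming (injective to from-injective)

  injective⇒surjective : (f : A → A) → Injective _≡_ _≡_ f → Surjective _≡_ _≡_ f
  injective⇒surjective f f-injective = strictlySurjective⇒surjective λ y →
    let i , hit = Fin-injective⇒strictlySurjective (to ∘ f ∘ from) (from-injective ∘ f-injective ∘ to-injective) (to y)
    in from i , to-injective hit

  enumeration : List A
  enumeration = tabulate from

  enumeration-unique : Unique enumeration
  enumeration-unique = tabulate⁺ from-injective

  ∈-enumeration : ∀ x → x ∈ enumeration
  ∈-enumeration x = subst (_∈ enumeration) (strictlyInverseʳ x) (∈-tabulate⁺ (to x))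

  length-enumeration : length enumeration ≡ n
  length-enumeration = length-tabulate from

module OrbitCounting {A : Set} (_≟_ : DecidableEquality A) (σ : A → A) (q : ℕ)
  (period : ∀ x → iterate σ x (suc q) ≡ x) (a : A) (σa≡a : σ a ≡ a) where

  open Nat using (_+_; _*_)
  open import Data.List.Membership.DecPropositional _≟_ using (_∈?_; _∉?_)

  orbit : A → List A
  orbit x = List.iterate σ x (suc q)

  σ-injective : Injective _≡_ _≡_ σ
  σ-injective {x} {y} e = trans (sym (period x)) (trans (cong (λ z → iterate σ z q) e) (period y))

  iterate-suc : ∀ n x → iterate σ x (suc n) ≡ σ (iterate σ x n)
  iterate-suc zero    x = refl
  iterate-suc (suc n) x = iterate-suc n (σ x)

  iterate∈iterate : ∀ n x → iterate σ x n ∈ List.iterate σ x (suc n)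
  iterate∈iterate zero    x = here refl
  iterate∈iterate (suc n) x = there (iterate∈iterate n (σ x))

  σ∈iterate⇒∈iterate : ∀ n {x y} → σ y ∈ List.iterate σ (σ x) n → y ∈ List.iterate σ x (suc n)
  σ∈iterate⇒∈iterate (suc n) (here σy≡σx) = here (σ-injective σy≡σx)
  σ∈iterate⇒∈iterate (suc n) (there σy∈)  = there (σ∈iterate⇒∈iterate n σy∈)

  σ∈orbit⇒∈orbit : ∀ {x y} → σ y ∈ orbit x → y ∈ orbit x
  σ∈orbit⇒∈orbit {x} (here σy≡x) =
    subst (_∈ orbit x) (σ-injective (trans (sym (iterate-suc q x)) (trans (period x) (sym σy≡x)))) (iterate∈iterate q x)
  σ∈orbit⇒∈orbit (there σy∈) = σ∈iterate⇒∈iterate q σy∈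

  fixed∈iterate⇒≡ : ∀ n {x} → a ∈ List.iterate σ x n → x ≡ a
  fixed∈iterate⇒≡ (suc n) (here a≡x) = sym a≡x
  fixed∈iterate⇒≡ (suc n) (there a∈) = σ-injective (trans (fixed∈iterate⇒≡ n a∈) (sym σa≡a))

  Closed : List A → Set
  Closed L = ∀ {y} → y ∈ L → σ y ∈ L

  iterate⊆closed : ∀ {L} → Closed L → ∀ n {x} → x ∈ L → List.iterate σ x n ⊆ L
  iterate⊆closed closed (suc n) x∈L (here refl) = x∈L
  iterate⊆closed closed (suc n) x∈L (there y∈)  = iterate⊆closed closed n (closed x∈L) y∈

  module _ (orbit-unique : ∀ x → x ≢ a → Unique (orbit x)) where

    outside : A → List A → List A
    outside x = filter (_∉? orbit x)

    length-outside : ∀ {x L} → x ≢ a → x ∈ L → Closed L → Unique L →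
                     length L ≡ suc q + length (outside x L)
    length-outside {x} {L} x≢a x∈L closed L! = begin
      length L                          ≡⟨ unique∧set⇒length≡ L! split! L∼split ⟩
      length (orbit x ++ outside x L)   ≡⟨ length-++ (orbit x) ⟩
      length (orbit x) + length (outside x L) ≡⟨ cong (_+ length (outside x L)) (length-iterate σ x (suc q)) ⟩
      suc q + length (outside x L)      ∎
      where
      open ≡-Reasoning
      split! : Unique (orbit x ++ outside x L)
      split! = ++⁺ (orbit-unique x x≢a) (filter⁺ (_∉? orbit x) L!) λ (y∈ , y∈out) → proj₂ (∈-filter⁻ (_∉? orbit x) {xs = L} y∈out) y∈
      L∼split : L ∼[ set ] (orbit x ++ outside x L)
      L∼split {y} = mk⇔ into ([ iterate⊆closed closed (suc q) x∈L , proj₁ ∘ ∈-filter⁻ (_∉? orbit x) ]′ ∘ ∈-++⁻ (orbit x))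
        where
        into : y ∈ L → y ∈ orbit x ++ outside x L
        into y∈L with y ∈? orbit x
        ... | yes y∈ = ∈-++⁺ˡ y∈
        ... | no  y∉ = ∈-++⁺ʳ (orbit x) (∈-filter⁺ (_∉? orbit x) y∈L y∉)

    outside-closed : ∀ {x L} → Closed L → Closed (outside x L)
    outside-closed {x} closed y∈out =
      let y∈L , y∉ = ∈-filter⁻ (_∉? orbit x) y∈out
      in ∈-filter⁺ (_∉? orbit x) (closed y∈L) (y∉ ∘ σ∈orbit⇒∈orbit)

    -- Remove one orbit at a time; closedness under σ keeps the remaining orbits whole.
    size≡1+k*p : ∀ L → Unique L → Closed L → a ∈ L → ∃ λ k → length L ≡ 1 + k * suc q
    size≡1+k*p L = <-rec P count (length L) L refl
      where
      P : ℕ → Set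
      P n = ∀ L → length L ≡ n → Unique L → Closed L → a ∈ L → ∃ λ k → length L ≡ 1 + k * suc q
      count : ∀ n → (∀ {m} → m < n → P m) → P n
      count _ rec L refl L! closed a∈L with Any.any? (λ y → ¬? (y ≟ a)) L
      ... | yes other =
        let x , x∈L , x≢a = find other
            L≡            = length-outside x≢a x∈L closed L!
            k , out≡      = rec (subst (length (outside x L) <_) (sym L≡) (s≤s (m≤n+m _ q))) (outside x L) refl
                              (filter⁺ (_∉? orbit x) L!) (outside-closed closed)
                              (∈-filter⁺ (_∉? orbit x) a∈L (x≢a ∘ fixed∈iterate⇒≡ (suc q)))
        in suc k , trans L≡ (trans (cong (suc q +_) out≡) (ℕₚ.+-suc (suc q) (k * suc q)))
      ... | no none = 0 , unique∧set⇒length≡ L! ([] ∷ []) (mk⇔ (here ∘ all≡a) λ { (here refl) → a∈L })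
        where
        all≡a : ∀ {y} → y ∈ L → y ≡ a
        all≡a {y} y∈L = decidable-stable (y ≟ a) λ y≢a → none (lose y∈L y≢a)

    card≡1+k*p : ∀ {n} → A ↔ Fin n → ∃ λ k → n ≡ 1 + k * suc q
    card≡1+k*p A↔Fin =
      let k , eq = size≡1+k*p (enumeration A↔Fin) (enumeration-unique A↔Fin)
                     (λ {y} _ → ∈-enumeration A↔Fin (σ y)) (∈-enumeration A↔Fin a)
      in k , trans (sym (length-enumeration A↔Fin)) eq

-- The polynomials of the argument, over an arbitrary raw ring so that they serve both as field
-- elements and as solver expressions; f is the f of Defs.
module Forms {r₁ r₂} (R : RawRing r₁ r₂) where
  open RawRing R

  f : Carrier → Carrier → Carrier → Carrier
  f x y z = x * x * x + x * x * y + x * y * y + x * x * z + y * z * z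

  cube : Carrier → Carrier
  cube u = u * u * u

  norm : Carrier → Carrier → Carrier
  norm u v = u * u + u * v + v * v

  ℓ₁ ℓ₂ ℓ₃ : Carrier → Carrier → Carrier → Carrier
  ℓ₁ t u v = t * u + (norm u v + t) * v
  ℓ₂ t u v = (norm u v + t) * u + norm u v * v
  ℓ₃ t u v = norm u v * u + t * v

module _ {m : ℕ} (K : GF m) where
  open GF K

  commutativeRing : CommutativeRing 0ℓ 0ℓ
  commutativeRing = record { isCommutativeRing = isCommutativeRing }

  open CommutativeRing commutativeRing
    using (*-comm; *-assoc; *-identityˡ; zeroʳ; distribʳ; -‿inverseʳ)
  open RingProperties (CommutativeRing.ring commutativeRing) using (-‿involutive; -0#≈0#)

  open Forms (CommutativeRing.rawRing commutativeRing) using (f; cube; norm; ℓ₁; ℓ₂; ℓ₃)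

  K³ : Set
  K³ = Carrier × Carrier × Carrier

  _≟_ : DecidableEquality Carrier
  _≟_ = inj⇒≟ (↔⇒↣ card)

  x*y≡0⇒x≡0⊎y≡0 : ∀ {x y} → x * y ≡ 0# → x ≡ 0# ⊎ y ≡ 0#
  x*y≡0⇒x≡0⊎y≡0 {x} {y} xy≡0 with x ≟ 0#
  ... | yes x≡0 = inj₁ x≡0
  ... | no  x≢0 = let x⁻¹ , xx⁻¹≡1 = inverse x x≢0 in inj₂ (begin
    y              ≡⟨ sym (*-identityˡ y) ⟩
    1# * y         ≡⟨ cong (_* y) (trans (sym xx⁻¹≡1) (*-comm x x⁻¹)) ⟩
    x⁻¹ * x * y    ≡⟨ *-assoc x⁻¹ x y ⟩
    x⁻¹ * (x * y)  ≡⟨ cong (x⁻¹ *_) xy≡0 ⟩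
    x⁻¹ * 0#       ≡⟨ zeroʳ x⁻¹ ⟩
    0#             ∎)
    where open ≡-Reasoning

  characteristic-two : 0 < m → 1# + 1# ≡ 0#
  characteristic-two 0<m with (1# + 1#) ≟ 0#
  ... | yes 2≡0 = 2≡0
  ... | no  2≢0 = let k , 2^m≡1+2k = card≡1+k*p pairs-unique card in ⊥-elim (2^n≢1+k*2 k 0<m 2^m≡1+2k)
    where
    x≡-x⇒x≡0 : ∀ x → x ≡ - x → x ≡ 0#
    x≡-x⇒x≡0 x x≡-x = fromInj₂ (⊥-elim ∘ 2≢0) (x*y≡0⇒x≡0⊎y≡0 (begin
      (1# + 1#) * x   ≡⟨ distribʳ x 1# 1# ⟩
      1# * x + 1# * x ≡⟨ cong₂ _+_ (*-identityˡ x) (trans (*-identityˡ x) x≡-x) ⟩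
      x + - x         ≡⟨ -‿inverseʳ x ⟩
      0#              ∎))
      where open ≡-Reasoning
    open OrbitCounting _≟_ -_ 1 -‿involutive 0# -0#≈0#
    pairs-unique : ∀ x → x ≢ 0# → Unique (orbit x)
    pairs-unique x x≢0 = ((x≢0 ∘ x≡-x⇒x≡0 x) ∷ []) ∷ [] ∷ []

  module Characteristic-two (char-two : 1# + 1# ≡ 0#) where
    open CommutativeRing commutativeRing using (+-identityˡ; +-identityʳ; zeroˡ; *-identityʳ; +-group)
    open GroupProperties +-group using (∙-cancelˡ; ∙-cancelʳ; inverseʳ-unique)

    bit : Bool → Carrier
    bit false = 0#
    bit true  = 1#

    -1≡1 : - 1# ≡ 1#
    -1≡1 = sym (inverseʳ-unique 1# 1# char-two)

    -- 𝔽₂ = (Bool, xor, ∧) maps into K, so the solver with Boolean coefficients proves the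
    -- identities that hold in characteristic two.
    bit-homomorphism : CommutativeRing.rawRing xor-∧-commutativeRing -Raw-AlmostCommutative⟶ fromCommutativeRing commutativeRing
    bit-homomorphism = record
      { ⟦_⟧    = bit
      ; +-homo = λ { false false → sym (+-identityʳ 0#) ; false true → sym (+-identityˡ 1#)
                   ; true false → sym (+-identityʳ 1#) ; true true → sym char-two }
      ; *-homo = λ { false false → sym (zeroʳ 0#) ; false true → sym (zeroˡ 1#)
                   ; true false → sym (zeroʳ 1#) ; true true → sym (*-identityʳ 1#) }
      ; -‿homo = λ { false → sym -0#≈0# ; true → sym -1≡1 }
      ; 0-homo = refl
      ; 1-homo = refl
      }

    open Solver (CommutativeRing.rawRing xor-∧-commutativeRing) (fromCommutativeRing commutativeRing) bit-homomorphism
      (λ b b′ → Maybe.map (cong bit) (dec⇒maybe (b ≟ᵇ b′)))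
      using (solve; _:=_; _:+_; _:*_; :-_; con; Polynomial)

    polynomials : ℕ → RawRing 0ℓ 0ℓ
    polynomials n = record
      { Carrier = Polynomial n ; _≈_ = _≡_ ; _+_ = _:+_ ; _*_ = _:*_ ; -_ = :-_ ; 0# = con false ; 1# = con true }

    module Poly {n} = Forms (polynomials n)

    x+y≡0⇒x≡y : ∀ {x y} → x + y ≡ 0# → x ≡ y
    x+y≡0⇒x≡y {x} {y} x+y≡0 = begin
      x            ≡⟨ solve 2 (λ x y → x := x :+ y :+ y) refl x y ⟩
      x + y + y    ≡⟨ cong (_+ y) x+y≡0 ⟩
      0# + y       ≡⟨ +-identityˡ y ⟩
      y            ∎
      where open ≡-Reasoning

    x≡y⇒x+y≡0 : ∀ {x y} → x ≡ y → x + y ≡ 0#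
    x≡y⇒x+y≡0 {x} refl = solve 1 (λ x → x :+ x := con false) refl x

    cramer : ∀ {a b c d u v u′ v′} → a * d + b * c ≢ 0# →
             a * u + b * v ≡ a * u′ + b * v′ → c * u + d * v ≡ c * u′ + d * v′ → u ≡ u′ × v ≡ v′
    cramer {a} {b} {c} {d} {u} {v} {u′} {v′} det≢0 e₁ e₂ = eliminate u-elimination , eliminate v-elimination
      where
      eliminate : ∀ {w w′} → (a * d + b * c) * (w + w′) ≡ 0# → w ≡ w′
      eliminate e = x+y≡0⇒x≡y (fromInj₂ (⊥-elim ∘ det≢0) (x*y≡0⇒x≡0⊎y≡0 e))
      combination≡0 : ∀ p r → p * (a * u + b * v + (a * u′ + b * v′)) + r * (c * u + d * v + (c * u′ + d * v′)) ≡ 0#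
      combination≡0 p r = trans (cong₂ (λ l l′ → p * l + r * l′) (x≡y⇒x+y≡0 e₁) (x≡y⇒x+y≡0 e₂))
                                (solve 2 (λ p r → p :* con false :+ r :* con false := con false) refl p r)
      u-elimination : (a * d + b * c) * (u + u′) ≡ 0#
      u-elimination = trans (solve 8 (λ a b c d u v u′ v′ →
          (a :* d :+ b :* c) :* (u :+ u′) :=
          d :* (a :* u :+ b :* v :+ (a :* u′ :+ b :* v′)) :+ b :* (c :* u :+ d :* v :+ (c :* u′ :+ d :* v′)))
          refl a b c d u v u′ v′) (combination≡0 d b)
      v-elimination : (a * d + b * c) * (v + v′) ≡ 0#
      v-elimination = trans (solve 8 (λ a b c d u v u′ v′ →
          (a :* d :+ b :* c) :* (v :+ v′) :=
          c :* (a :* u :+ b :* v :+ (a :* u′ :+ b :* v′)) :+ a :* (c :* u :+ d :* v :+ (c :* u′ :+ d :* v′)))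
          refl a b c d u v u′ v′) (combination≡0 c a)

    no-cube-root-of-unity : Odd m → ∀ w → w * w + w + 1# ≢ 0#
    no-cube-root-of-unity odd w root = let k , 2^m≡1+3k = card≡1+k*p triples-unique card in 2^odd≢1+k*3 k odd 2^m≡1+3k
      where
      open ≡-Reasoning
      w³≡1 : ∀ x → w * (w * (w * x)) ≡ x
      w³≡1 x = begin
        w * (w * (w * x))                    ≡⟨ solve 2 (λ w x → w :* (w :* (w :* x)) :=
                                                  x :+ (w :+ con true) :* x :* (w :* w :+ w :+ con true)) refl w x ⟩
        x + (w + 1#) * x * (w * w + w + 1#)  ≡⟨ cong (λ r → x + (w + 1#) * x * r) root ⟩
        x + (w + 1#) * x * 0#                ≡⟨ solve 2 (λ w x → x :+ (w :+ con true) :* x :* con false := x) refl w x ⟩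
        x                                    ∎
      open OrbitCounting _≟_ (w *_) 2 w³≡1 0# (zeroʳ w)
      w*x≡x⇒x≡0 : ∀ x → w * x ≡ x → x ≡ 0#
      w*x≡x⇒x≡0 x wx≡x = begin
        x                                    ≡⟨ sym (w³≡1 x) ⟩
        w * (w * (w * x))                    ≡⟨ cong (w *_) (begin
          w * (w * x)                          ≡⟨ solve 2 (λ w x → w :* (w :* x) :=
                                                    (w :* w :+ w :+ con true) :* x :+ (w :* x :+ x)) refl w x ⟩
          (w * w + w + 1#) * x + (w * x + x)   ≡⟨ cong₂ (λ r s → r * x + s) root (x≡y⇒x+y≡0 wx≡x) ⟩
          0# * x + 0#                          ≡⟨ solve 1 (λ x → con false :* x :+ con false := con false) refl x ⟩
          0#                                   ∎) ⟩
        w * 0#                               ≡⟨ zeroʳ w ⟩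
        0#                                   ∎
      triples-unique : ∀ x → x ≢ 0# → Unique (orbit x)
      triples-unique x x≢0 = (x≢wx ∷ x≢w²x ∷ []) ∷ (x≢wx ∘ σ-injective ∷ []) ∷ [] ∷ []
        where
        x≢wx : x ≢ w * x
        x≢wx = x≢0 ∘ w*x≡x⇒x≡0 x ∘ sym
        x≢w²x : x ≢ w * (w * x)
        x≢w²x x≡w²x = x≢0 (w*x≡x⇒x≡0 x (trans (cong (w *_) x≡w²x) (w³≡1 x)))

    translate : Carrier → K³ → K³
    translate c (a , b , d) = c + a , c + b , c + d

    translate-injective : ∀ c → Injective _≡_ _≡_ (translate c)
    translate-injective c {a , b , d} {a′ , b′ , d′} e =
      cong₂ _,_ (cancel (cong proj₁ e)) (cong₂ _,_ (cancel (cong (proj₁ ∘ proj₂) e)) (cancel (cong (proj₂ ∘ proj₂) e)))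
      where
      cancel : ∀ {x y} → c + x ≡ c + y → x ≡ y
      cancel = ∙-cancelˡ c _ _

    sum : K³ → Carrier
    sum (a , b , d) = a + b + d

    e₂ : K³ → Carrier
    e₂ (a , b , d) = a * b + b * d + d * a

    ℓ : Carrier → Carrier → Carrier → K³
    ℓ t u v = ℓ₁ t u v , ℓ₂ t u v , ℓ₃ t u v

    sum-ℓ : ∀ t u v → sum (ℓ t u v) ≡ 0#
    sum-ℓ = solve 3 (λ t u v → Poly.ℓ₁ t u v :+ Poly.ℓ₂ t u v :+ Poly.ℓ₃ t u v := con false) refl

    e₂-ℓ : ∀ t u v → e₂ (ℓ t u v) + cube t ≡ cube (norm u v + t)
    e₂-ℓ = solve 3 (λ t u v →
      Poly.ℓ₁ t u v :* Poly.ℓ₂ t u v :+ Poly.ℓ₂ t u v :* Poly.ℓ₃ t u v :+ Poly.ℓ₃ t u v :* Poly.ℓ₁ t u v :+ Poly.cube t :=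
      Poly.cube (Poly.norm u v :+ t)) refl

    G : K³ → K³
    G (s , u , v) = translate (cube s) (ℓ (s * s) u v)

    sum-G : ∀ s u v → sum (G (s , u , v)) ≡ cube s
    sum-G s u v = begin
      sum (G (s , u , v))                     ≡⟨ solve 4 (λ c a b d → (c :+ a) :+ (c :+ b) :+ (c :+ d) := c :+ (a :+ b :+ d))
                                                   refl (cube s) (ℓ₁ (s * s) u v) (ℓ₂ (s * s) u v) (ℓ₃ (s * s) u v) ⟩
      cube s + sum (ℓ (s * s) u v)            ≡⟨ cong (cube s +_) (sum-ℓ (s * s) u v) ⟩
      cube s + 0#                             ≡⟨ +-identityʳ (cube s) ⟩
      cube s                                  ∎
      where open ≡-Reasoning

    coordinates : K³ → K³
    coordinates (x , y , z) = x + y + z , y + z , z + x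

    F≗G∘coordinates : ∀ p → F K p ≡ G (coordinates p)
    F≗G∘coordinates (x , y , z) = cong₂ _,_ (component₁ x y z) (cong₂ _,_ (component₂ x y z) (component₃ x y z))
      where
      component₁ : ∀ x y z → f x y z ≡ cube (x + y + z) + ℓ₁ ((x + y + z) * (x + y + z)) (y + z) (z + x)
      component₁ = solve 3 (λ x y z →
        Poly.f x y z := Poly.cube (x :+ y :+ z) :+ Poly.ℓ₁ ((x :+ y :+ z) :* (x :+ y :+ z)) (y :+ z) (z :+ x)) refl
      component₂ : ∀ x y z → f y z x ≡ cube (x + y + z) + ℓ₂ ((x + y + z) * (x + y + z)) (y + z) (z + x)
      component₂ = solve 3 (λ x y z →
        Poly.f y z x := Poly.cube (x :+ y :+ z) :+ Poly.ℓ₂ ((x :+ y :+ z) :* (x :+ y :+ z)) (y :+ z) (z :+ x)) refl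
      component₃ : ∀ x y z → f z x y ≡ cube (x + y + z) + ℓ₃ ((x + y + z) * (x + y + z)) (y + z) (z + x)
      component₃ = solve 3 (λ x y z →
        Poly.f z x y := Poly.cube (x :+ y :+ z) :+ Poly.ℓ₃ ((x :+ y :+ z) :* (x :+ y :+ z)) (y :+ z) (z :+ x)) refl

    coordinates-injective : Injective _≡_ _≡_ coordinates
    coordinates-injective {p} {p′} e = trans (sym (recover p)) (trans (cong from-coordinates e) (recover p′))
      where
      from-coordinates : K³ → K³
      from-coordinates (s , u , v) = s + u , s + v , s + u + v
      recover : ∀ p → from-coordinates (coordinates p) ≡ p
      recover (x , y , z) = cong₂ _,_
        (solve 3 (λ x y z → x :+ y :+ z :+ (y :+ z) := x) refl x y z)
        (cong₂ _,_ (solve 3 (λ x y z → x :+ y :+ z :+ (z :+ x) := y) refl x y z)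
                   (solve 3 (λ x y z → x :+ y :+ z :+ (y :+ z) :+ (z :+ x) := z) refl x y z))

    module _ (no-cube-root : ∀ w → w * w + w + 1# ≢ 0#) where

      norm≡0⇒≡0 : ∀ {u v} → norm u v ≡ 0# → u ≡ 0# × v ≡ 0#
      norm≡0⇒≡0 {u} {v} n≡0 with v ≟ 0#
      ... | yes refl = reduce (x*y≡0⇒x≡0⊎y≡0 u*u≡0) , refl
        where
        u*u≡0 : u * u ≡ 0#
        u*u≡0 = trans (solve 1 (λ u → u :* u := u :* u :+ u :* con false :+ con false :* con false) refl u) n≡0
      ... | no v≢0 = ⊥-elim ([ v≢0 ∘ v*v≡0⇒v≡0 , no-cube-root (u * v⁻¹) ]′ (x*y≡0⇒x≡0⊎y≡0 scaled≡0))
        where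
        open ≡-Reasoning
        v⁻¹ : Carrier
        v⁻¹ = proj₁ (inverse v v≢0)
        vv⁻¹≡1 : v * v⁻¹ ≡ 1#
        vv⁻¹≡1 = proj₂ (inverse v v≢0)
        v*v≡0⇒v≡0 : v * v ≡ 0# → v ≡ 0#
        v*v≡0⇒v≡0 vv≡0 = reduce (x*y≡0⇒x≡0⊎y≡0 vv≡0)
        scaled≡0 : v * v * (u * v⁻¹ * (u * v⁻¹) + u * v⁻¹ + 1#) ≡ 0#
        scaled≡0 = begin
          v * v * (u * v⁻¹ * (u * v⁻¹) + u * v⁻¹ + 1#)
            ≡⟨ solve 3 (λ u v i → v :* v :* (u :* i :* (u :* i) :+ u :* i :+ con true) :=
                                  u :* u :* (v :* i) :* (v :* i) :+ u :* v :* (v :* i) :+ v :* v) refl u v v⁻¹ ⟩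
          u * u * (v * v⁻¹) * (v * v⁻¹) + u * v * (v * v⁻¹) + v * v
            ≡⟨ cong (λ e → u * u * e * e + u * v * e + v * v) vv⁻¹≡1 ⟩
          u * u * 1# * 1# + u * v * 1# + v * v
            ≡⟨ solve 2 (λ u v → u :* u :* con true :* con true :+ u :* v :* con true :+ v :* v := Poly.norm u v) refl u v ⟩
          norm u v
            ≡⟨ n≡0 ⟩
          0# ∎

      cube-injective : Injective _≡_ _≡_ cube
      cube-injective {u} {v} u³≡v³ =
        [ x+y≡0⇒x≡y , (λ n≡0 → let u≡0 , v≡0 = norm≡0⇒≡0 n≡0 in trans u≡0 (sym v≡0)) ]′
          (x*y≡0⇒x≡0⊎y≡0 (trans factorisation (x≡y⇒x+y≡0 u³≡v³)))
        where
        factorisation : (u + v) * norm u v ≡ cube u + cube v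
        factorisation = solve 2 (λ u v → (u :+ v) :* Poly.norm u v := Poly.cube u :+ Poly.cube v) refl u v

      ℓ-determines-norm : ∀ {t u v u′ v′} → ℓ t u v ≡ ℓ t u′ v′ → norm u v ≡ norm u′ v′
      ℓ-determines-norm {t} {u} {v} {u′} {v′} ℓ≡ℓ′ = ∙-cancelʳ t _ _ (cube-injective (begin
        cube (norm u v + t)       ≡⟨ sym (e₂-ℓ t u v) ⟩
        e₂ (ℓ t u v) + cube t     ≡⟨ cong (λ p → e₂ p + cube t) ℓ≡ℓ′ ⟩
        e₂ (ℓ t u′ v′) + cube t   ≡⟨ e₂-ℓ t u′ v′ ⟩
        cube (norm u′ v′ + t)     ∎))
        where open ≡-Reasoning

      -- Either norm (norm u v) t = 0, forcing norm u v = norm u′ v′ = 0, or ℓ₁ and ℓ₃ form a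
      -- linear system in (u, v) with that nonzero determinant.
      ℓ-injective : ∀ {t u v u′ v′} → ℓ t u v ≡ ℓ t u′ v′ → u ≡ u′ × v ≡ v′
      ℓ-injective {t} {u} {v} {u′} {v′} ℓ≡ℓ′ with norm (norm u v) t ≟ 0#
      ... | yes N≡0 =
        let u≡0 , v≡0 = norm≡0⇒≡0 (proj₁ (norm≡0⇒≡0 N≡0))
            u′≡0 , v′≡0 = norm≡0⇒≡0 (trans (sym (ℓ-determines-norm ℓ≡ℓ′)) (proj₁ (norm≡0⇒≡0 N≡0)))
        in trans u≡0 (sym u′≡0) , trans v≡0 (sym v′≡0)
      ... | no N≢0 = cramer det≢0 (trans (cong proj₁ ℓ≡ℓ′) (cong (λ n → t * u′ + (n + t) * v′) (sym n≡n′)))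
                                  (trans (cong (proj₂ ∘ proj₂) ℓ≡ℓ′) (cong (λ n → n * u′ + t * v′) (sym n≡n′)))
        where
        n≡n′ : norm u v ≡ norm u′ v′
        n≡n′ = ℓ-determines-norm ℓ≡ℓ′
        det≢0 : t * t + (norm u v + t) * norm u v ≢ 0#
        det≢0 = N≢0 ∘ trans (solve 2 (λ n t → Poly.norm n t := t :* t :+ (n :+ t) :* n) refl (norm u v) t)

      G-injective : Injective _≡_ _≡_ G
      G-injective {s , u , v} {s′ , u′ , v′} G≡G′ = cong₂ _,_ s≡s′ (cong₂ _,_ (proj₁ u≡u′×v≡v′) (proj₂ u≡u′×v≡v′))
        where
        s≡s′ : s ≡ s′
        s≡s′ = cube-injective (trans (sym (sum-G s u v)) (trans (cong sum G≡G′) (sum-G s′ u′ v′)))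
        ℓ≡ℓ′ : ℓ (s * s) u v ≡ ℓ (s * s) u′ v′
        ℓ≡ℓ′ = translate-injective (cube s) (trans G≡G′ (cong (λ r → G (r , u′ , v′)) (sym s≡s′)))
        u≡u′×v≡v′ : u ≡ u′ × v ≡ v′
        u≡u′×v≡v′ = ℓ-injective {s * s} {u} {v} {u′} {v′} ℓ≡ℓ′

      F-injective : Injective _≡_ _≡_ (F K)
      F-injective {p} {p′} F≡F′ = coordinates-injective (G-injective (begin
        G (coordinates p)    ≡⟨ sym (F≗G∘coordinates p) ⟩
        F K p                ≡⟨ F≡F′ ⟩
        F K p′               ≡⟨ F≗G∘coordinates p′ ⟩
        G (coordinates p′)   ∎))
        where open ≡-Reasoning

theorem2 : (m : ℕ) → Odd m → (K : GF m) → IsPermutation K (F K)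
theorem2 m odd@(j , refl) K = injective , injective⇒surjective (×-↔Fin card (×-↔Fin card card)) (F K) injective
  where
  open GF K using (card)
  open Characteristic-two K (characteristic-two K (s≤s z≤n))
  injective : Injective _≡_ _≡_ (F K)
  injective = F-injective (no-cube-root-of-unity odd)
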